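{- There exists an infinite family of 2D strings of size $N$ with $\delta = \Omega(g N/\log^3 N)$.
   Context: A 2D string $\mathcal{M}_{m\times n}$ is an $m\times n$ matrix over a finite alphabet, of size $N=mn$. $P_\mathcal{M}(k_1,k_2)$ is the number of distinct $k_1\times k_2$ submatrices of $\mathcal{M}$, and $\delta(\mathcal{M})=\max\{P_\mathcal{M}(k_1,k_2)/(k_1k_2) : 1\le k_1\le m, 1\le k_2\le n\}$. Horizontal concatenation, denoted here $A\oplus B$ (written in the paper with a rotated $\ominus$ symbol), places $B$ to the right of $A$ (equal numbers of rows); vertical concatenation $A\ominus B$ places $B$ below $A$ (equal numbers of columns). A 2D SLP is a context-free grammar uniquely generating $\mathcal{M}$ with rules $A\to a$ (size 1), $A\to B\oplus C$, $A\to B\ominus C$ (size 2); $g(\mathcal{M})$ is the size of the smallest 2D SLP generating $\mathcal{M}$. -}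

module Defs where

open import Data.Nat as ℕ using (ℕ; zero; suc; _+_; _*_; _∸_; _≤_)
open import Data.Fin using (Fin)
import Data.Fin as Fin
open import Data.Vec as Vec using (Vec)
open import Data.List as List using (List; []; _∷_; upTo; map; concatMap; length; deduplicate; take; drop; foldr)
import Data.List.Properties as LP
open import Data.Integer using (+_)
open import Data.Rational as ℚ using (ℚ; 0ℚ; _⊔_; _/_)
open import Data.Maybe using (Maybe; just; nothing)
open import Data.Product using (Σ; _,_; _×_; ∃)
open import Relation.Nullary using (yes; no)
open import Relation.Binary.PropositionalEquality using (_≡_; refl)

Mat : ℕ → ℕ → ℕ → Set
Mat σ m n = Vec (Vec (Fin σ) n) m

rowsL : ∀ {σ m n} → Mat σ m n → List (List (Fin σ))
rowsL M = Vec.toList (Vec.map Vec.toList M)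

-- the k1 × k2 submatrix with top-left corner (i , j) (0-based)
sub : ∀ {σ} → List (List (Fin σ)) → ℕ → ℕ → ℕ → ℕ → List (List (Fin σ))
sub R i j k1 k2 = map (λ r → take k2 (drop j r)) (take k1 (drop i R))

P : ∀ {σ m n} → Mat σ m n → ℕ → ℕ → ℕ
P {σ} {m} {n} M k1 k2 =
  length (deduplicate (LP.≡-dec (LP.≡-dec Fin._≟_))
    (concatMap (λ i → map (λ j → sub (rowsL M) i j k1 k2) (upTo (suc (n ∸ k2))))
               (upTo (suc (m ∸ k1)))))

-- δ(M) = max { P_M(k1,k2) / (k1 k2) : 1 ≤ k1 ≤ m, 1 ≤ k2 ≤ n }  (0 if M is empty)
δ : ∀ {σ m n} → Mat σ m n → ℚ
δ {σ} {m} {n} M =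
  foldr _⊔_ 0ℚ
    (concatMap (λ a → map (λ b → (+ P M (suc a) (suc b)) / (suc a * suc b)) (upTo n))
               (upTo m))

-- 2D straight-line programs.  Rule k may refer only to nonterminals 0 .. k-1.
data Rule (σ k : ℕ) : Set where
  term : Fin σ → Rule σ k
  hor  : Fin k → Fin k → Rule σ k      -- A → B ⦶ C  (C to the right of B)
  ver  : Fin k → Fin k → Rule σ k      -- A → B ⊖ C  (C below B)

data SLP (σ : ℕ) : ℕ → Set where
  []  : SLP σ 0
  _▸_ : ∀ {k} → SLP σ k → Rule σ k → SLP σ (suc k)

AnyMat : ℕ → Set
AnyMat σ = Σ ℕ λ m → Σ ℕ λ n → Mat σ m n

horCat : ∀ {σ} → Maybe (AnyMat σ) → Maybe (AnyMat σ) → Maybe (AnyMat σ)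
horCat (just (m , n , A)) (just (m' , n' , B)) with m ℕ.≟ m'
... | yes refl = just (m , n + n' , Vec.zipWith Vec._++_ A B)
... | no _ = nothing
horCat _ _ = nothing

verCat : ∀ {σ} → Maybe (AnyMat σ) → Maybe (AnyMat σ) → Maybe (AnyMat σ)
verCat (just (m , n , A)) (just (m' , n' , B)) with n ℕ.≟ n'
... | yes refl = just (m + m' , n , A Vec.++ B)
... | no _ = nothing
verCat _ _ = nothing

-- value of every nonterminal (nothing = ill-formed concatenation)
eval : ∀ {σ k} → SLP σ k → Vec (Maybe (AnyMat σ)) k
eval [] = Vec.[]
eval (G ▸ term a) = eval G Vec.∷ʳ just (1 , 1 , (a Vec.∷ Vec.[]) Vec.∷ Vec.[])
eval (G ▸ hor b c) = eval G Vec.∷ʳ horCat (Vec.lookup (eval G) b) (Vec.lookup (eval G) c)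
eval (G ▸ ver b c) = eval G Vec.∷ʳ verCat (Vec.lookup (eval G) b) (Vec.lookup (eval G) c)

ruleSize : ∀ {σ k} → Rule σ k → ℕ
ruleSize (term _) = 1
ruleSize (hor _ _) = 2
ruleSize (ver _ _) = 2

size : ∀ {σ k} → SLP σ k → ℕ
size [] = 0
size (G ▸ r) = size G + ruleSize r

-- G generates M: its start symbol (the last rule) evaluates to M
Generates : ∀ {σ k m n} → SLP σ (suc k) → Mat σ m n → Set
Generates {m = m} {n} (G ▸ r) M = Vec.last (eval (G ▸ r)) ≡ just (m , n , M)

IsSmallestSLPSize : ∀ {σ m n} → Mat σ m n → ℕ → Set
IsSmallestSLPSize {σ} M g =
  (Σ ℕ λ k → Σ (SLP σ (suc k)) λ G → Generates G M × size G ≡ g)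
  × (∀ k (G : SLP σ (suc k)) → Generates G M → g ≤ size G)

{-# OPTIONS --safe #-}
module Submission where

-- Take for M the 2ⁿ × n matrix whose rows are all binary words of length n, so N = n 2ⁿ and
-- log₂ N ≥ n. Its rows are pairwise distinct, hence P_M(1, n) = 2ⁿ and δ(M) ≥ 2ⁿ / n. The words
-- of length n + 1 are obtained from those of length n by putting a 0-column and a 1-column in
-- front and stacking the two results, and the constant columns double by stacking, so five
-- rules of size 2 per unit of length suffice and g(M) ≤ 10 n. Therefore
-- g N ≤ 10 n² 2ⁿ ≤ 10 δ(M) n³ ≤ 10 δ(M) (log₂ N)³.

open import Defs
open import Data.Nat as ℕ using (ℕ; zero; suc; _+_; _*_; _^_; _∸_; _≤_; _<_; NonZero)
open import Data.Nat.Properties as ℕP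
  using (≤-trans; ≤-reflexive; +-monoʳ-≤; *-monoˡ-≤; *-monoʳ-≤; ^-monoˡ-≤; module ≤-Reasoning)
open import Data.Nat.Logarithm using (⌊log₂_⌋; ⌊log₂⌋-mono-≤; ⌊log₂[2^n]⌋≡n)
open import Data.Nat.Tactic.RingSolver using (solve-∀)
open import Data.Integer as ℤ using (+_)
import Data.Integer.Properties as ℤP
open import Data.Rational as Q using (ℚ; Positive; _/_; 0ℚ; _⊔_; toℚᵘ)
import Data.Rational.Properties as QP
open import Data.Rational.Unnormalised as ℚᵘ using (mkℚᵘ; _≃_)
import Data.Rational.Unnormalised.Properties as ℚᵘP
open import Data.Fin as Fin using (Fin; inject₁; fromℕ; #_)
open import Data.Vec as Vec using (Vec; _∷_; []; _∷ʳ_; lookup; last; replicate)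
import Data.Vec.Properties as VecP
open import Data.List as List using (List; map; upTo; applyUpTo; concatMap; length; deduplicate; [_])
import Data.List.Properties as ListP
open import Data.List.Relation.Unary.All using (All; []; _∷_)
open import Data.List.Relation.Unary.AllPairs using ([]; _∷_)
open import Data.List.Relation.Unary.Unique.Propositional using (Unique)
import Data.List.Relation.Unary.Unique.Propositional.Properties as UniqueP
open import Data.List.Relation.Unary.Any using (here; there)
open import Data.List.Membership.Propositional using (_∈_)
open import Data.List.Membership.Propositional.Properties using (∈-map⁺; ∈-map⁻; ∈-concat⁺′; ∈-upTo⁺)
open import Data.Maybe using (just)
open import Data.Product using (Σ; _×_; _,_)
open import Data.Empty using (⊥)
open import Relation.Nullary using (¬?)
open import Relation.Binary.Definitions using (DecidableEquality)
open import Relation.Binary.PropositionalEquality hiding ([_])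
open import Function using (_∘_)

record Derives {σ k m n} (G : SLP σ k) (M : Mat σ m n) : Set where
  constructor derivation
  field
    index        : Fin k
    lookup-index : lookup (eval G) index ≡ just (m , n , M)
open Derives using (index)

lookup-∷ʳ-inject₁ : ∀ {A : Set} {n} (xs : Vec A n) x i → lookup (xs ∷ʳ x) (inject₁ i) ≡ lookup xs i
lookup-∷ʳ-inject₁ (y ∷ xs) x Fin.zero    = refl
lookup-∷ʳ-inject₁ (y ∷ xs) x (Fin.suc i) = lookup-∷ʳ-inject₁ xs x i

last≡lookup-fromℕ : ∀ {A : Set} {n} (xs : Vec A (suc n)) → last xs ≡ lookup xs (fromℕ n)
last≡lookup-fromℕ (x ∷ [])     = refl
last≡lookup-fromℕ (x ∷ y ∷ xs) = last≡lookup-fromℕ (y ∷ xs)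

Derives-▸ : ∀ {σ k m n} {G : SLP σ k} {M : Mat σ m n} r → Derives G M → Derives (G ▸ r) M
Derives-▸ {G = G} r (derivation i d) = derivation (inject₁ i) (trans (new r) d)
  where
  new : ∀ r → lookup (eval (G ▸ r)) (inject₁ i) ≡ lookup (eval G) i
  new (term _)  = lookup-∷ʳ-inject₁ (eval G) _ i
  new (hor _ _) = lookup-∷ʳ-inject₁ (eval G) _ i
  new (ver _ _) = lookup-∷ʳ-inject₁ (eval G) _ i

Generates⇒Derives : ∀ {σ k m n} (G : SLP σ (suc k)) {M : Mat σ m n} → Generates G M → Derives G M
Generates⇒Derives (G ▸ r) gen = derivation (fromℕ _) (trans (sym (last≡lookup-fromℕ (eval (G ▸ r)))) gen)

horCat-just : ∀ {σ m n n'} (A : Mat σ m n) (B : Mat σ m n') →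
  horCat (just (m , n , A)) (just (m , n' , B)) ≡ just (m , n + n' , Vec.zipWith Vec._++_ A B)
horCat-just {m = m} A B rewrite ℕP.≟-diag {m} refl = refl

verCat-just : ∀ {σ m m' n} (A : Mat σ m n) (B : Mat σ m' n) →
  verCat (just (m , n , A)) (just (m' , n , B)) ≡ just (m + m' , n , A Vec.++ B)
verCat-just {n = n} A B rewrite ℕP.≟-diag {n} refl = refl

hor-Generates : ∀ {σ k m n n'} {G : SLP σ k} {A : Mat σ m n} {B : Mat σ m n'}
  (x : Derives G A) (y : Derives G B) → Generates (G ▸ hor (index x) (index y)) (Vec.zipWith Vec._++_ A B)
hor-Generates {G = G} {A} {B} (derivation _ dA) (derivation _ dB) =
  trans (VecP.last-∷ʳ _ (eval G)) (trans (cong₂ horCat dA dB) (horCat-just A B))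

ver-Generates : ∀ {σ k m m' n} {G : SLP σ k} {A : Mat σ m n} {B : Mat σ m' n}
  (x : Derives G A) (y : Derives G B) → Generates (G ▸ ver (index x) (index y)) (A Vec.++ B)
ver-Generates {G = G} {A} {B} (derivation _ dA) (derivation _ dB) =
  trans (VecP.last-∷ʳ _ (eval G)) (trans (cong₂ verCat dA dB) (verCat-just A B))

pow2 : ℕ → ℕ
pow2 zero    = 1
pow2 (suc n) = pow2 n + pow2 n

pow2≡2^ : ∀ n → pow2 n ≡ 2 ^ n
pow2≡2^ zero    = refl
pow2≡2^ (suc n) = cong₂ _+_ (pow2≡2^ n) (trans (pow2≡2^ n) (sym (ℕP.+-identityʳ (2 ^ n))))

pow2-pos : ∀ n → 0 < pow2 n
pow2-pos n = subst (0 <_) (sym (pow2≡2^ n)) (ℕP.m^n>0 2 n)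

binaryWords : ∀ n → Mat 2 (pow2 n) n
binaryWords zero    = [] ∷ []
binaryWords (suc n) = Vec.map (# 0 ∷_) (binaryWords n) Vec.++ Vec.map (# 1 ∷_) (binaryWords n)

column : ∀ {σ} m → Fin σ → Mat σ m 1
column m a = replicate m (a ∷ [])

replicate-+ : ∀ {A : Set} m n (x : A) → replicate (m + n) x ≡ replicate m x Vec.++ replicate n x
replicate-+ zero    n x = refl
replicate-+ (suc m) n x = cong (x ∷_) (replicate-+ m n x)

column-++ : ∀ {σ} m (a : Fin σ) → column m a Vec.++ column m a ≡ column (m + m) a
column-++ m a = sym (replicate-+ m m (a ∷ []))

column-zipWith : ∀ {σ m n} (a : Fin σ) (A : Mat σ m n) → Vec.zipWith Vec._++_ (column m a) A ≡ Vec.map (a ∷_) A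
column-zipWith a A = VecP.zipWith-replicate₁ Vec._++_ (a ∷ []) A

record BinaryWordsSLP (j : ℕ) : Set where
  field
    {k}        : ℕ
    grammar    : SLP 2 (suc k)
    zeros      : Derives grammar (column (pow2 (suc j)) (# 0))
    ones       : Derives grammar (column (pow2 (suc j)) (# 1))
    generates  : Generates grammar (binaryWords (suc j))
    size-bound : size grammar ≤ suc j * 10

-- G₁, G₂ double the constant columns; G₃, G₄, G₅ build (0-column ⦶ W) ⊖ (1-column ⦶ W).
binaryWordsSLP-suc : ∀ {j} → BinaryWordsSLP j → BinaryWordsSLP (suc j)
binaryWordsSLP-suc {j} S = record
  { grammar    = G₅
  ; zeros      = Derives-▸ _ (Derives-▸ _ (Derives-▸ _ (Derives-▸ _ zeros₁)))
  ; ones       = Derives-▸ _ (Derives-▸ _ (Derives-▸ _ ones₂))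
  ; generates  = subst (Generates G₅) (cong₂ Vec._++_ (column-zipWith (# 0) W) (column-zipWith (# 1) W))
                   (ver-Generates zerosW₄ onesW)
  ; size-bound = ≤-trans (≤-reflexive (+10 (size grammar))) (+-monoʳ-≤ 10 size-bound)
  }
  where
  open BinaryWordsSLP S
  W = binaryWords (suc j)
  m = pow2 (suc j)

  words : Derives grammar W
  words = Generates⇒Derives grammar generates

  G₁ = grammar ▸ ver (index zeros) (index zeros)
  zeros₁ : Derives G₁ (column (m + m) (# 0))
  zeros₁ = Generates⇒Derives G₁ (subst (Generates G₁) (column-++ m (# 0)) (ver-Generates zeros zeros))
  ones₁ : Derives G₁ (column m (# 1))
  ones₁ = Derives-▸ _ ones

  G₂ = G₁ ▸ ver (index ones₁) (index ones₁)
  ones₂ : Derives G₂ (column (m + m) (# 1))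
  ones₂ = Generates⇒Derives G₂ (subst (Generates G₂) (column-++ m (# 1)) (ver-Generates ones₁ ones₁))
  zeros₂ : Derives G₂ (column m (# 0))
  zeros₂ = Derives-▸ _ (Derives-▸ _ zeros)
  words₂ : Derives G₂ W
  words₂ = Derives-▸ _ (Derives-▸ _ words)

  G₃ = G₂ ▸ hor (index zeros₂) (index words₂)
  zerosW : Derives G₃ (Vec.zipWith Vec._++_ (column m (# 0)) W)
  zerosW = Generates⇒Derives G₃ (hor-Generates zeros₂ words₂)
  ones₃ : Derives G₃ (column m (# 1))
  ones₃ = Derives-▸ _ (Derives-▸ _ (Derives-▸ _ ones))
  words₃ : Derives G₃ W
  words₃ = Derives-▸ _ words₂

  G₄ = G₃ ▸ hor (index ones₃) (index words₃)
  onesW : Derives G₄ (Vec.zipWith Vec._++_ (column m (# 1)) W)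
  onesW = Generates⇒Derives G₄ (hor-Generates ones₃ words₃)
  zerosW₄ : Derives G₄ (Vec.zipWith Vec._++_ (column m (# 0)) W)
  zerosW₄ = Derives-▸ _ zerosW

  G₅ = G₄ ▸ ver (index zerosW₄) (index onesW)

  +10 : ∀ s → s + 2 + 2 + 2 + 2 + 2 ≡ 10 + s
  +10 = solve-∀

binaryWordsSLP : ∀ j → BinaryWordsSLP j
binaryWordsSLP zero = record
  { grammar    = ((((([] ▸ term (# 0)) ▸ term (# 1)) ▸ ver (# 0) (# 0)) ▸ ver (# 1) (# 1)) ▸ ver (# 0) (# 1))
  ; zeros      = derivation (# 2) refl
  ; ones       = derivation (# 3) refl
  ; generates  = refl
  ; size-bound = ℕP.m≤m+n 8 2
  }
binaryWordsSLP (suc j) = binaryWordsSLP-suc (binaryWordsSLP j)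

rowsL-++ : ∀ {σ m m' n} (A : Mat σ m n) (B : Mat σ m' n) → rowsL (A Vec.++ B) ≡ rowsL A List.++ rowsL B
rowsL-++ []      B = refl
rowsL-++ (r ∷ A) B = cong (Vec.toList r List.∷_) (rowsL-++ A B)

rowsL-map-∷ : ∀ {σ m n} (a : Fin σ) (A : Mat σ m n) → rowsL (Vec.map (a ∷_) A) ≡ map (a List.∷_) (rowsL A)
rowsL-map-∷ a []      = refl
rowsL-map-∷ a (r ∷ A) = cong ((a List.∷ Vec.toList r) List.∷_) (rowsL-map-∷ a A)

rowsL-width : ∀ {σ m n} (A : Mat σ m n) → All (λ r → length r ≡ n) (rowsL A)
rowsL-width []      = []
rowsL-width (r ∷ A) = VecP.length-toList r ∷ rowsL-width A

binaryWords-unique : ∀ n → Unique (rowsL (binaryWords n))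
binaryWords-unique zero    = [] ∷ []
binaryWords-unique (suc n) = subst Unique (sym rows)
  (UniqueP.++⁺ (UniqueP.map⁺ ListP.∷-injectiveʳ u) (UniqueP.map⁺ ListP.∷-injectiveʳ u) disjoint)
  where
  R = rowsL (binaryWords n)
  u = binaryWords-unique n
  rows : rowsL (binaryWords (suc n)) ≡ map (# 0 List.∷_) R List.++ map (# 1 List.∷_) R
  rows = trans (rowsL-++ (Vec.map (# 0 ∷_) (binaryWords n)) (Vec.map (# 1 ∷_) (binaryWords n)))
               (cong₂ List._++_ (rowsL-map-∷ (# 0) (binaryWords n)) (rowsL-map-∷ (# 1) (binaryWords n)))
  disjoint : ∀ {w} → w ∈ map (# 0 List.∷_) R × w ∈ map (# 1 List.∷_) R → ⊥
  disjoint (p , q) with ∈-map⁻ (# 0 List.∷_) p | ∈-map⁻ (# 1 List.∷_) q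
  ... | _ , _ , refl | _ , _ , ()

deduplicate-unique : ∀ {A : Set} (_≟_ : DecidableEquality A) {xs} → Unique xs → deduplicate _≟_ xs ≡ xs
deduplicate-unique _≟_ []                    = refl
deduplicate-unique _≟_ {x List.∷ xs} (x∉ ∷ u) =
  cong (x List.∷_) (trans (cong (List.filter (¬? ∘ (x ≟_))) (deduplicate-unique _≟_ u))
                          (ListP.filter-all (¬? ∘ (x ≟_)) x∉))

row-windows : ∀ {σ} n (R : List (List (Fin σ))) → All (λ r → length r ≡ n) R →
  applyUpTo (λ i → sub R i 0 1 n) (length R) ≡ map [_] R
row-windows n List.[]      []          = refl
row-windows n (r List.∷ R) (|r| ∷ |R|) =
  cong₂ List._∷_ (cong [_] (ListP.take-all n r (≤-reflexive |r|))) (row-windows n R |R|)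

full-width-windows : ∀ {σ} n (R : List (List (Fin σ))) → All (λ r → length r ≡ n) R →
  concatMap (λ i → map (λ j → sub R i j 1 n) (upTo (suc (n ∸ n)))) (upTo (length R)) ≡ map [_] R
full-width-windows n R widths rewrite ℕP.n∸n≡0 n = begin
  concatMap (λ i → [ sub R i 0 1 n ]) (upTo (length R))       ≡⟨ ListP.concatMap-map [_] _ (upTo (length R)) ⟨
  concatMap [_] (map (λ i → sub R i 0 1 n) (upTo (length R))) ≡⟨ ListP.concatMap-pure _ ⟩
  map (λ i → sub R i 0 1 n) (upTo (length R))                 ≡⟨ ListP.map-upTo _ (length R) ⟩
  applyUpTo (λ i → sub R i 0 1 n) (length R)                  ≡⟨ row-windows n R widths ⟩
  map [_] R                                                   ∎
  where open ≡-Reasoning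

P-full-width : ∀ {σ m n} (M : Mat σ m n) → 0 < m → Unique (rowsL M) → P M 1 n ≡ m
P-full-width {σ} {suc m} {n} M _ u = begin
  length (deduplicate ≟ (concatMap windows (upTo (suc m))))
    ≡⟨ cong (λ t → length (deduplicate ≟ (concatMap windows (upTo t)))) |R| ⟨
  length (deduplicate ≟ (concatMap windows (upTo (length R))))
    ≡⟨ cong (length ∘ deduplicate ≟) (full-width-windows n R (rowsL-width M)) ⟩
  length (deduplicate ≟ (map [_] R))
    ≡⟨ cong length (deduplicate-unique ≟ (UniqueP.map⁺ ListP.∷-injectiveˡ u)) ⟩
  length (map [_] R)
    ≡⟨ ListP.length-map [_] R ⟩
  length R
    ≡⟨ |R| ⟩
  suc m ∎
  where
  open ≡-Reasoning
  R = rowsL M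
  ≟ = ListP.≡-dec (ListP.≡-dec Fin._≟_)
  windows = λ i → map (λ j → sub R i j 1 n) (upTo (suc (n ∸ n)))
  |R| : length R ≡ suc m
  |R| = VecP.length-toList (Vec.map Vec.toList M)

≤-foldr-⊔ : ∀ {p} xs → p ∈ xs → p Q.≤ List.foldr _⊔_ 0ℚ xs
≤-foldr-⊔ (q List.∷ xs) (here refl) = QP.p≤p⊔q q _
≤-foldr-⊔ (q List.∷ xs) (there p∈) = QP.p≤q⇒p≤r⊔q q (≤-foldr-⊔ xs p∈)

P/≤δ : ∀ {σ m n} (M : Mat σ m n) {a b} → a < m → b < n →
  (+ P M (suc a) (suc b)) / (suc a * suc b) Q.≤ δ M
P/≤δ M a<m b<n = ≤-foldr-⊔ _ (∈-concat⁺′ (∈-map⁺ _ (∈-upTo⁺ b<n)) (∈-map⁺ _ (∈-upTo⁺ a<m)))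

toℚᵘ-/ : ∀ a b .{{_ : NonZero b}} → toℚᵘ (+ a / b) ≃ (+ a) ℚᵘ./ b
toℚᵘ-/ a (suc b) = QP.toℚᵘ-fromℚᵘ (mkℚᵘ (+ a) b)

toℚᵘ-/-*-/ : ∀ a b c d .{{_ : NonZero b}} .{{_ : NonZero d}} →
  toℚᵘ ((+ a / b) Q.* (+ c / d)) ≃ ((+ a) ℚᵘ./ b) ℚᵘ.* ((+ c) ℚᵘ./ d)
toℚᵘ-/-*-/ a b c d =
  ℚᵘP.≃-trans (QP.toℚᵘ-homo-* (+ a / b) (+ c / d)) (ℚᵘP.*-cong (toℚᵘ-/ a b) (toℚᵘ-/ c d))

/-*-/-mono-≤ : ∀ a b c d a' b' c' d'
  .{{_ : NonZero b}} .{{_ : NonZero d}} .{{_ : NonZero b'}} .{{_ : NonZero d'}} →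
  a * c * (b' * d') ≤ a' * c' * (b * d) → (+ a / b) Q.* (+ c / d) Q.≤ (+ a' / b') Q.* (+ c' / d')
/-*-/-mono-≤ a b@(suc _) c d@(suc _) a' b'@(suc _) c' d'@(suc _) ac≤a'c' = QP.toℚᵘ-cancel-≤ (begin
  toℚᵘ ((+ a / b) Q.* (+ c / d))          ≃⟨ toℚᵘ-/-*-/ a b c d ⟩
  ((+ a) ℚᵘ./ b) ℚᵘ.* ((+ c) ℚᵘ./ d)      ≤⟨ ℚᵘ.*≤* (subst₂ ℤ._≤_ (+-*-+ a c (b' * d')) (+-*-+ a' c' (b * d))
                                                                (ℤ.+≤+ ac≤a'c')) ⟩
  ((+ a') ℚᵘ./ b') ℚᵘ.* ((+ c') ℚᵘ./ d')  ≃⟨ toℚᵘ-/-*-/ a' b' c' d' ⟨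
  toℚᵘ ((+ a' / b') Q.* (+ c' / d'))      ∎)
  where
  open ℚᵘP.≤-Reasoning
  +-*-+ : ∀ x y z → + (x * y * z) ≡ + x ℤ.* + y ℤ.* + z
  +-*-+ x y z = trans (ℤP.pos-* (x * y) z) (cong (ℤ._* + z) (ℤP.pos-* x y))

n≤⌊log₂[2ⁿn]⌋ : ∀ n .{{_ : NonZero n}} → n ≤ ⌊log₂ (pow2 n * n) ⌋
n≤⌊log₂[2ⁿn]⌋ n = subst (_≤ ⌊log₂ (pow2 n * n) ⌋) (⌊log₂[2^n]⌋≡n n)
  (⌊log₂⌋-mono-≤ (subst (_≤ pow2 n * n) (pow2≡2^ n) (ℕP.m≤m*n (pow2 n) n)))

-- The shape is the hypothesis of /-*-/-mono-≤ for (1/10) · (g m n / 1) ≤ (m / (1 · n)) · (L³ / 1).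
cross-multiplied-bound : ∀ {g m n L} → g ≤ n * 10 → n ≤ L →
  1 * (g * (m * n)) * (1 * n * 1) ≤ m * L ^ 3 * (10 * 1)
cross-multiplied-bound {g} {m} {n} {L} g≤10n n≤L = begin
  1 * (g * (m * n)) * (1 * n * 1) ≡⟨ lhs g m n ⟩
  g * (m * n * n)                 ≤⟨ *-monoˡ-≤ (m * n * n) g≤10n ⟩
  n * 10 * (m * n * n)            ≡⟨ middle m n ⟩
  m * n ^ 3 * (10 * 1)            ≤⟨ *-monoˡ-≤ (10 * 1) (*-monoʳ-≤ m (^-monoˡ-≤ 3 n≤L)) ⟩
  m * L ^ 3 * (10 * 1)            ∎
  where
  open ≤-Reasoning
  lhs : ∀ g m n → 1 * (g * (m * n)) * (1 * n * 1) ≡ g * (m * n * n)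
  lhs = solve-∀
  middle : ∀ m n → n * 10 * (m * n * n) ≡ m * (n * (n * (n * 1))) * (10 * 1)
  middle = solve-∀

binaryWords-g≤ : ∀ j {g} → IsSmallestSLPSize (binaryWords (suc j)) g → g ≤ suc j * 10
binaryWords-g≤ j (_ , minimal) = ≤-trans (minimal _ grammar generates) size-bound
  where open BinaryWordsSLP (binaryWordsSLP j)

binaryWords-δ-bound : ∀ j g → g ≤ suc j * 10 →
  (+ 1 / 10) Q.* (+ (g * (pow2 (suc j) * suc j)) / 1)
    Q.≤ δ (binaryWords (suc j)) Q.* (+ (⌊log₂ (pow2 (suc j) * suc j) ⌋ ^ 3) / 1)
binaryWords-δ-bound j g g≤10n = begin
  (+ 1 / 10) Q.* (+ (g * (m * n)) / 1)
    ≤⟨ /-*-/-mono-≤ 1 10 (g * (m * n)) 1 m (1 * n) L³ 1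
         (cross-multiplied-bound {m = m} g≤10n (n≤⌊log₂[2ⁿn]⌋ n)) ⟩
  (+ m / (1 * n)) Q.* (+ L³ / 1)
    ≤⟨ QP.*-monoʳ-≤-nonNeg (+ L³ / 1) {{QP.normalize-nonNeg L³ 1}} m/n≤δ ⟩
  δ W Q.* (+ L³ / 1) ∎
  where
  open QP.≤-Reasoning
  n = suc j
  m = pow2 n
  W = binaryWords n
  L³ = ⌊log₂ (m * n) ⌋ ^ 3
  m/n≤δ : + m / (1 * n) Q.≤ δ W
  m/n≤δ = subst (λ p → + p / (1 * n) Q.≤ δ W) (P-full-width W (pow2-pos n) (binaryWords-unique n))
                (P/≤δ W (pow2-pos n) (ℕP.n<1+n j))

proposition10 : Σ ℚ λ c → Positive c × ((n₀ : ℕ) →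
                  Σ ℕ λ σ → Σ ℕ λ m → Σ ℕ λ n → Σ (Mat σ m n) λ M →
                    n₀ ≤ m * n ×
                    ((g : ℕ) → IsSmallestSLPSize M g →
                      c Q.* ((+ (g * (m * n))) / 1)
                        Q.≤ δ M Q.* ((+ (⌊log₂ (m * n) ⌋ ^ 3)) / 1)))
proposition10 = + 1 / 10 , _ , λ n₀ →
  2 , pow2 (suc n₀) , suc n₀ , binaryWords (suc n₀) , n₀≤N n₀ ,
  λ g g-min → binaryWords-δ-bound n₀ g (binaryWords-g≤ n₀ g-min)
  where
  n₀≤N : ∀ n₀ → n₀ ≤ pow2 (suc n₀) * suc n₀
  n₀≤N n₀ = ≤-trans (ℕP.n≤1+n n₀)
    (ℕP.m≤n*m (suc n₀) (pow2 (suc n₀)) {{ℕ.>-nonZero (pow2-pos (suc n₀))}})
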